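{- Let $n_1,\ldots,n_k$ be positive integers. If the box $B(n_1,n_2,\ldots,n_k)$ is good and $n_1 > 1$, then $B(n_1-1,n_2,\ldots,n_k)$ is good.
   Context: For positive integers $m$, $[m]=\{1,\ldots,m\}$. For positive integers $n_1,\ldots,n_k$, the box is $B(n_1,\ldots,n_k) = [2n_1]\times\cdots\times[2n_k]$, and $\partial B(n_1,\ldots,n_k)$ is the set of $x \in B(n_1,\ldots,n_k)$ with $x_i \in \{1, 2n_i\}$ for some $i \in [k]$. For $x,y$ in the box, write $x \sim y$ if $x=y$ or $|x_i-y_i|=1$ for some $i\in[k]$. The box is good if there is a subset $S \subseteq \partial B(n_1,\ldots,n_k)$ with $|S| = 2^k$ and $x\sim y$ for all $x,y\in S$. -}

module Defs where

open import Data.Nat using (ℕ; suc; _*_; _^_; _≤_; ∣_-_∣)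
open import Data.Fin using (Fin; zero; suc)
open import Data.Vec using (Vec; lookup)
open import Data.Nat using (_∸_)
open import Data.Product using (Σ; ∃; _×_)
open import Data.Sum using (_⊎_)
open import Data.List using (List; length)
open import Data.List.Relation.Unary.All using (All)
open import Data.List.Relation.Unary.Unique.Propositional using (Unique)
open import Relation.Binary.PropositionalEquality using (_≡_)

Point : ℕ → Set
Point k = Vec ℕ k

InBox : {k : ℕ} → (Fin k → ℕ) → Point k → Set
InBox n x = ∀ i → (1 ≤ lookup x i) × (lookup x i ≤ 2 * n i)

InBoundary : {k : ℕ} → (Fin k → ℕ) → Point k → Set
InBoundary n x = InBox n x × ∃ λ i → (lookup x i ≡ 1) ⊎ (lookup x i ≡ 2 * n i)

_∼_ : {k : ℕ} → Point k → Point k → Set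
x ∼ y = (x ≡ y) ⊎ (∃ λ i → ∣ lookup x i - lookup y i ∣ ≡ 1)

Good : (k : ℕ) → (Fin k → ℕ) → Set
Good k n = Σ (List (Point k)) λ S →
  Unique S × length S ≡ 2 ^ k × All (InBoundary n) S
  × All (λ x → All (λ y → x ∼ y) S) S

decFirst : {k : ℕ} → (Fin (suc k) → ℕ) → (Fin (suc k) → ℕ)
decFirst n zero = n zero ∸ 1
decFirst n (suc i) = n (suc i)

{-# OPTIONS --safe #-}
-- Fold the first coordinate along 1 2 3 4 5 … 2n₁ ↦ 1 2 1 2 3 … 2n₁−2.  Values at distance 1
-- stay at distance 1, and the faces x₁ = 1, x₁ = 2n₁ go to the faces x₁ = 1, x₁ = 2n₁−2, so
-- the fold maps boundary to boundary and preserves ∼.  It is also injective on a ∼-clique: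
-- two distinct members differ by exactly 1 in some coordinate, and then so do their images.
module Submission where

open import Defs
open import Data.Nat using (ℕ; zero; suc; _*_; _+_; _∸_; _<_; _≤_; ∣_-_∣; s≤s; z≤n)
open import Data.Nat.Properties using (∣n-n∣≡0; ∣-∣-comm; 0≢1+n; *-suc; *-monoʳ-≤; <⇒≤)
open import Data.Fin using (Fin; zero; suc)
open import Data.Vec using (_∷_; lookup)
open import Data.List using (List; []; _∷_; map)
open import Data.List.Properties using (length-map)
open import Data.List.Relation.Unary.All as All using (All; []; _∷_)
open import Data.List.Relation.Unary.All.Properties as All using ()
open import Data.List.Relation.Unary.AllPairs as AllPairs using (AllPairs; []; _∷_)
open import Data.List.Relation.Unary.AllPairs.Properties as AllPairs using ()
open import Data.List.Relation.Unary.Unique.Propositional using (Unique)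
open import Data.Product using (_,_; ∃)
open import Data.Sum using (_⊎_; inj₁; inj₂)
open import Relation.Nullary using (¬_; contradiction)
open import Relation.Binary.PropositionalEquality using (_≡_; _≢_; refl; sym; trans; cong; subst)

∣n-suc-n∣≡1 : ∀ n → ∣ n - suc n ∣ ≡ 1
∣n-suc-n∣≡1 zero    = refl
∣n-suc-n∣≡1 (suc n) = ∣n-suc-n∣≡1 n

∣m-n∣≡1⇒ : ∀ m n → ∣ m - n ∣ ≡ 1 → n ≡ suc m ⊎ m ≡ suc n
∣m-n∣≡1⇒ zero    n       d = inj₁ d
∣m-n∣≡1⇒ (suc m) zero    d = inj₂ d
∣m-n∣≡1⇒ (suc m) (suc n) d with ∣m-n∣≡1⇒ m n d
... | inj₁ n≡1+m = inj₁ (cong suc n≡1+m)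
... | inj₂ m≡1+n = inj₂ (cong suc m≡1+n)

2*m≡2+2*[m∸1] : ∀ {m} → 1 ≤ m → 2 * m ≡ 2 + 2 * (m ∸ 1)
2*m≡2+2*[m∸1] {suc m} (s≤s z≤n) = *-suc 2 m

2≤2*[m∸1] : ∀ {m} → 1 < m → 2 ≤ 2 * (m ∸ 1)
2≤2*[m∸1] {suc (suc m)} (s≤s (s≤s z≤n)) = *-monoʳ-≤ 2 (s≤s z≤n)

fold : ℕ → ℕ
fold (suc (suc (suc a))) = suc a
fold a                   = a

fold-suc : ∀ a → ∣ fold a - fold (suc a) ∣ ≡ 1
fold-suc 0                   = refl
fold-suc 1                   = refl
fold-suc 2                   = refl
fold-suc (suc (suc (suc a))) = ∣n-suc-n∣≡1 a

fold-adjacent : ∀ a b → ∣ a - b ∣ ≡ 1 → ∣ fold a - fold b ∣ ≡ 1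
fold-adjacent a b d with ∣m-n∣≡1⇒ a b d
... | inj₁ refl = fold-suc a
... | inj₂ refl = trans (∣-∣-comm (fold a) (fold b)) (fold-suc b)

fold-positive : ∀ {a} → 1 ≤ a → 1 ≤ fold a
fold-positive {1}                 _ = s≤s z≤n
fold-positive {2}                 _ = s≤s z≤n
fold-positive {suc (suc (suc a))} _ = s≤s z≤n

fold-≤ : ∀ {a t} → 2 ≤ t → a ≤ 2 + t → fold a ≤ t
fold-≤ {0}                 _   _                 = z≤n
fold-≤ {1}                 2≤t _                 = <⇒≤ 2≤t
fold-≤ {2}                 2≤t _                 = 2≤t
fold-≤ {suc (suc (suc a))} _   (s≤s (s≤s a+1≤t)) = a+1≤t

fold-top : ∀ {t} → 1 ≤ t → fold (2 + t) ≡ t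
fold-top {suc t} _ = refl

Neighbour : ∀ {k} → Point k → Point k → Set
Neighbour x y = ∃ λ i → ∣ lookup x i - lookup y i ∣ ≡ 1

Neighbour-irrefl : ∀ {k} (x : Point k) → ¬ Neighbour x x
Neighbour-irrefl x (i , d) = 0≢1+n (trans (sym (∣n-n∣≡0 (lookup x i))) d)

∼-distinct⇒Neighbour : ∀ {k} {x y : Point k} → x ∼ y → x ≢ y → Neighbour x y
∼-distinct⇒Neighbour (inj₁ x≡y) x≢y = contradiction x≡y x≢y
∼-distinct⇒Neighbour (inj₂ nb)   _   = nb

Clique : ∀ {k} → List (Point k) → Set
Clique S = All (λ x → All (x ∼_) S) S

Unique-Clique⇒AllPairs-Neighbour : ∀ {k} {S : List (Point k)} →
  Unique S → Clique S → AllPairs Neighbour S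
Unique-Clique⇒AllPairs-Neighbour []             []                  = []
Unique-Clique⇒AllPairs-Neighbour (x≢xs ∷ uniq) ((_ ∷ x∼xs) ∷ rows) =
  All.zipWith (λ (x∼y , x≢y) → ∼-distinct⇒Neighbour x∼y x≢y) (x∼xs , x≢xs)
  ∷ Unique-Clique⇒AllPairs-Neighbour uniq (All.map All.tail rows)

AllPairs-Neighbour⇒Unique : ∀ {k} {S : List (Point k)} → AllPairs Neighbour S → Unique S
AllPairs-Neighbour⇒Unique = AllPairs.map λ { {x} nb refl → Neighbour-irrefl x nb }

module _ {k} (n n′ : Fin k → ℕ) (f : Point k → Point k)
         (f-InBoundary : ∀ x → InBoundary n x → InBoundary n′ (f x))
         (f-Neighbour : ∀ x y → Neighbour x y → Neighbour (f x) (f y)) where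

  f-∼ : ∀ x y → x ∼ y → f x ∼ f y
  f-∼ x _ (inj₁ refl) = inj₁ refl
  f-∼ x y (inj₂ nb)   = inj₂ (f-Neighbour x y nb)

  map-Unique : ∀ {S} → Unique S → Clique S → Unique (map f S)
  map-Unique uniq clique = AllPairs-Neighbour⇒Unique
    (AllPairs.map⁺ (AllPairs.map (λ {x} {y} → f-Neighbour x y)
      (Unique-Clique⇒AllPairs-Neighbour uniq clique)))

  map-Clique : ∀ {S} → Clique S → Clique (map f S)
  map-Clique clique =
    All.map⁺ (All.map (λ {x} row → All.map⁺ (All.map (λ {y} → f-∼ x y) row)) clique)

  Good-map : Good k n → Good k n′
  Good-map (S , uniq , |S| , boundary , clique) =
    map f S , map-Unique uniq clique , trans (length-map f S) |S|
    , All.map⁺ (All.map (λ {x} → f-InBoundary x) boundary) , map-Clique clique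

foldHead : ∀ {k} → Point (suc k) → Point (suc k)
foldHead (a ∷ x) = fold a ∷ x

foldHead-Neighbour : ∀ {k} (x y : Point (suc k)) →
  Neighbour x y → Neighbour (foldHead x) (foldHead y)
foldHead-Neighbour (a ∷ x) (b ∷ y) (zero  , d) = zero , fold-adjacent a b d
foldHead-Neighbour (a ∷ x) (b ∷ y) (suc i , d) = suc i , d

module _ {k} (n : Fin (suc k) → ℕ) (1<n₀ : 1 < n zero) where

  private
    2n₀≡2+2n₀′ : 2 * n zero ≡ 2 + 2 * decFirst n zero
    2n₀≡2+2n₀′ = 2*m≡2+2*[m∸1] (<⇒≤ 1<n₀)

    2≤2n₀′ : 2 ≤ 2 * decFirst n zero
    2≤2n₀′ = 2≤2*[m∸1] 1<n₀

  foldHead-InBox : ∀ x → InBox n x → InBox (decFirst n) (foldHead x)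
  foldHead-InBox (a ∷ x) inBox zero    = let 1≤a , a≤2n₀ = inBox zero in
    fold-positive 1≤a , fold-≤ 2≤2n₀′ (subst (a ≤_) 2n₀≡2+2n₀′ a≤2n₀)
  foldHead-InBox (a ∷ x) inBox (suc i) = inBox (suc i)

  foldHead-InBoundary : ∀ x → InBoundary n x → InBoundary (decFirst n) (foldHead x)
  foldHead-InBoundary (a ∷ x) (inBox , zero , inj₁ a≡1) =
    foldHead-InBox (a ∷ x) inBox , zero , inj₁ (cong fold a≡1)
  foldHead-InBoundary (a ∷ x) (inBox , zero , inj₂ a≡2n₀) =
    foldHead-InBox (a ∷ x) inBox , zero ,
    inj₂ (trans (cong fold (trans a≡2n₀ 2n₀≡2+2n₀′)) (fold-top (<⇒≤ 2≤2n₀′)))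
  foldHead-InBoundary (a ∷ x) (inBox , suc i , face) =
    foldHead-InBox (a ∷ x) inBox , suc i , face

proposition2p3 : (k : ℕ) (n : Fin (suc k) → ℕ) → (∀ i → 1 ≤ n i) →
    Good (suc k) n → 1 < n zero →
    Good (suc k) (decFirst n)
proposition2p3 k n _ good 1<n₀ =
  Good-map n (decFirst n) foldHead (foldHead-InBoundary n 1<n₀) foldHead-Neighbour good
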